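{- Let $H$ be a propositional formula in conjunctive normal form, i.e. a finite set of clauses over a finite set of Boolean variables $\mathrm{Vars}(H)$. Then $H$ is unsatisfiable if and only if $H$ has a Stable Set of Assignments (SSA), i.e. there exist a set $P$ of full assignments to $\mathrm{Vars}(H)$, an assignment $p_{\mathrm{init}} \in P$, and an AC-mapping $\Phi$ from $P$ to $H$ such that for every $p \in P$, $\mathrm{Nbhd}(p_{\mathrm{init}}, p, \Phi(p)) \subseteq P$.
   Context: A clause is a disjunction of literals. For an assignment $p$ to a set of variables $V$ and a clause $C$ falsified by $p$, $\mathrm{Nbhd}(p, C)$ denotes the set of assignments to $V$ that satisfy $C$ and are at Hamming distance 1 from $p$ (equivalently, the assignments obtained from $p$ by flipping the value of a single variable occurring in $C$). For another assignment $q$ to $V$ (possibly equal to $p$), $\mathrm{Nbhd}(q, p, C)$ denotes the subset of $\mathrm{Nbhd}(p, C)$ consisting of those assignments whose Hamming distance to $q$ is strictly larger than the Hamming distance from $p$ to $q$. Given a formula $H$ (a set of clauses) and a set $P$ of assignments to $\mathrm{Vars}(H)$ each of which falsifies $H$, an AC-mapping is a map $\Phi: P \to H$ such that for every $p \in P$, $\Phi(p)$ is a clause of $H$ falsified by $p$. A set $P$ of assignments to $\mathrm{Vars}(H)$ is an SSA of $H$ with center $p_{\mathrm{init}} \in P$ if every assignment of $P$ falsifies $H$ and there is an AC-mapping $\Phi$ such that $\mathrm{Nbhd}(p_{\mathrm{init}}, p, \Phi(p)) \subseteq P$ for every $p \in P$. -}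

module Defs where

open import Data.Nat using (ℕ; _<_; suc)
open import Data.Fin using (Fin)
open import Data.Bool using (Bool; _≟_)
open import Data.Product using (_×_; Σ; ∃-syntax; _,_)
open import Data.List using (List)
open import Data.List.Membership.Propositional using (_∈_)
open import Data.List.Relation.Unary.Any using (Any)
open import Data.List.Relation.Unary.All using (All)
open import Data.Vec using (Vec; []; _∷_; lookup)
open import Relation.Binary.PropositionalEquality using (_≡_)
open import Relation.Nullary using (¬_; yes; no)

-- Variables are Fin n.  A literal is a pair (x , b): it is the positive
-- literal x when b = true and the negative literal ¬x when b = false.
Literal : ℕ → Set
Literal n = Fin n × Bool

var : ∀ {n} → Literal n → Fin n
var (x , _) = x

Clause : ℕ → Set
Clause n = List (Literal n)

CNF : ℕ → Set
CNF n = List (Clause n)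

Assignment : ℕ → Set
Assignment n = Vec Bool n

SatLit : ∀ {n} → Assignment n → Literal n → Set
SatLit p (x , b) = lookup p x ≡ b

SatClause : ∀ {n} → Assignment n → Clause n → Set
SatClause p C = Any (SatLit p) C

Falsifies : ∀ {n} → Assignment n → Clause n → Set
Falsifies p C = ¬ SatClause p C

SatCNF : ∀ {n} → Assignment n → CNF n → Set
SatCNF p H = All (SatClause p) H

FalsifiesCNF : ∀ {n} → Assignment n → CNF n → Set
FalsifiesCNF p H = ¬ SatCNF p H

Satisfiable : ∀ {n} → CNF n → Set
Satisfiable {n} H = ∃[ p ] SatCNF {n} p H

Unsatisfiable : ∀ {n} → CNF n → Set
Unsatisfiable H = ¬ Satisfiable H

-- Vars(H) = Fin n: every variable x : Fin n occurs in some clause of H.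
VarsExactly : ∀ {n} → CNF n → Set
VarsExactly {n} H = (x : Fin n) → Any (λ C → Any (λ l → var l ≡ x) C) H

hamming : ∀ {n} → Assignment n → Assignment n → ℕ
hamming [] [] = 0
hamming (a ∷ p) (b ∷ q) with a ≟ b
... | yes _ = hamming p q
... | no _ = suc (hamming p q)

-- Nbhd(p, C): assignments at Hamming distance 1 from p satisfying C,
-- i.e. obtained from p by flipping a single variable occurring in C
-- (C assumed falsified by p).
InNbhd : ∀ {n} → Assignment n → Clause n → Assignment n → Set
InNbhd p C r = SatClause r C × hamming p r ≡ 1

InNbhd3 : ∀ {n} → Assignment n → Assignment n → Clause n → Assignment n → Set
InNbhd3 q p C r = InNbhd p C r × hamming p q < hamming r q

-- Sets of assignments are represented as lists (membership _∈_).
-- Φ is an AC-mapping from P to H: Φ p is a clause of H falsified by p.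
IsACMapping : ∀ {n} → CNF n → List (Assignment n) → (Assignment n → Clause n) → Set
IsACMapping H P Φ = ∀ p → p ∈ P → (Φ p ∈ H) × Falsifies p (Φ p)

IsSSA : ∀ {n} → CNF n → List (Assignment n) → Assignment n → Set
IsSSA {n} H P pinit =
  pinit ∈ P ×
  (∀ p → p ∈ P → FalsifiesCNF p H) ×
  Σ (Assignment n → Clause n) λ Φ →
    IsACMapping H P Φ ×
    (∀ p → p ∈ P → ∀ r → InNbhd3 pinit p (Φ p) r → r ∈ P)

HasSSA : ∀ {n} → CNF n → Set
HasSSA {n} H = Σ (List (Assignment n)) λ P → Σ (Assignment n) λ pinit → IsSSA H P pinit

-- If s satisfies H, walk from the centre of an SSA towards s.  As long as the
-- current point p agrees with s wherever the centre does, the clause Φ p is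
-- satisfied by s but falsified by p, so it contains a variable on which p and
-- s differ; then the centre differs from s there too, so p agrees with the
-- centre on it, and flipping it yields a neighbour in Nbhd(centre, p, Φ p),
-- hence in P, one step closer to s.  The walk would reach s, which falsifies
-- nothing.  Conversely, for unsatisfiable H the set of all assignments is an SSA.
module Submission where

open import Defs
open import Data.Nat using (ℕ; zero; suc)
open import Data.Nat.Properties using (≤-reflexive; suc-injective; 0≢1+n)
open import Function.Bundles using (_⇔_; mk⇔)
open import Data.Fin using (Fin; zero; suc)
import Data.Fin as Fin
open import Data.Bool using (Bool; true; false; not)
import Data.Bool as Bool
open import Data.Bool.Properties using (¬-not)
open import Data.Product using (∃; _×_; _,_; proj₁; proj₂)
open import Data.List using (List; []; _∷_; [_]; cartesianProductWith)
open import Data.List.Membership.Propositional using (_∈_; find; lose)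
open import Data.List.Membership.Propositional.Properties using (∈-cartesianProductWith⁺)
open import Data.List.Relation.Unary.Any using (here; there; any?)
import Data.List.Relation.Unary.All as All
open import Data.List.Relation.Unary.All.Properties using (¬All⇒Any¬)
open import Data.Vec using (Vec; []; _∷_; lookup; updateAt; replicate)
open import Data.Vec.Properties using (lookup∘updateAt; lookup∘updateAt′)
open import Data.Empty using (⊥; ⊥-elim)
open import Relation.Binary.PropositionalEquality using (_≡_; _≢_; refl; sym; trans; cong)
open import Relation.Nullary using (yes; no)
open import Relation.Unary using (Decidable)

vectors : ∀ {a} {A : Set a} → List A → (n : ℕ) → List (Vec A n)
vectors xs zero    = [ [] ]
vectors xs (suc n) = cartesianProductWith _∷_ xs (vectors xs n)

∈-vectors : ∀ {a} {A : Set a} {xs : List A} → (∀ x → x ∈ xs) →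
            ∀ {n} (v : Vec A n) → v ∈ vectors xs n
∈-vectors complete []      = here refl
∈-vectors complete (x ∷ v) = ∈-cartesianProductWith⁺ _∷_ (complete x) (∈-vectors complete v)

∈-booleans : ∀ b → b ∈ true ∷ false ∷ []
∈-booleans true  = here refl
∈-booleans false = there (here refl)

satClause? : ∀ {n} (p : Assignment n) → Decidable (SatClause p)
satClause? p = any? (λ l → lookup p (proj₁ l) Bool.≟ proj₂ l)

falsifiedClause : ∀ {n} (p : Assignment n) {H : CNF n} → FalsifiesCNF p H →
                  ∃ λ C → C ∈ H × Falsifies p C
falsifiedClause p {H} p⊭H = find (¬All⇒Any¬ (satClause? p) H p⊭H)

separatingVariable : ∀ {n} (s p : Assignment n) {C : Clause n} →
                     SatClause s C → Falsifies p C →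
                     ∃ λ x → lookup p x ≢ lookup s x ×
                             (∀ r → lookup r x ≡ lookup s x → SatClause r C)
separatingVariable s p s⊨C p⊭C with find s⊨C
... | (x , b) , l∈C , sx≡b =
  x , (λ px≡sx → p⊭C (lose l∈C (trans px≡sx sx≡b)))
    , (λ r rx≡sx → lose l∈C (trans rx≡sx sx≡b))

flip : ∀ {n} → Assignment n → Fin n → Assignment n
flip p x = updateAt p x not

hamming-refl : ∀ {n} (p : Assignment n) → hamming p p ≡ 0
hamming-refl []          = refl
hamming-refl (true ∷ p)  = hamming-refl p
hamming-refl (false ∷ p) = hamming-refl p

hamming-flip : ∀ {n} (p : Assignment n) x → hamming p (flip p x) ≡ 1
hamming-flip (true ∷ p)  zero    = cong suc (hamming-refl p)
hamming-flip (false ∷ p) zero    = cong suc (hamming-refl p)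
hamming-flip (true ∷ p)  (suc x) = hamming-flip p x
hamming-flip (false ∷ p) (suc x) = hamming-flip p x

hamming-flip-agreeing : ∀ {n} (p q : Assignment n) x → lookup p x ≡ lookup q x →
                        hamming (flip p x) q ≡ suc (hamming p q)
hamming-flip-agreeing (true ∷ p)  (true ∷ q)  zero    _ = refl
hamming-flip-agreeing (false ∷ p) (false ∷ q) zero    _ = refl
hamming-flip-agreeing (a ∷ p)     (b ∷ q)     (suc x) e with a Bool.≟ b
... | yes _ = hamming-flip-agreeing p q x e
... | no _  = cong suc (hamming-flip-agreeing p q x e)

hamming-flip-disagreeing : ∀ {n} (p q : Assignment n) x → lookup p x ≢ lookup q x →
                           hamming p q ≡ suc (hamming (flip p x) q)
hamming-flip-disagreeing (true ∷ p)  (true ∷ q)  zero    ne = ⊥-elim (ne refl)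
hamming-flip-disagreeing (false ∷ p) (false ∷ q) zero    ne = ⊥-elim (ne refl)
hamming-flip-disagreeing (true ∷ p)  (false ∷ q) zero    _  = refl
hamming-flip-disagreeing (false ∷ p) (true ∷ q)  zero    _  = refl
hamming-flip-disagreeing (a ∷ p)     (b ∷ q)     (suc x) ne with a Bool.≟ b
... | yes _ = hamming-flip-disagreeing p q x ne
... | no _  = cong suc (hamming-flip-disagreeing p q x ne)

-- Over Bool this says exactly that p lies on a shortest path from c to s.
Between : ∀ {n} → Assignment n → Assignment n → Assignment n → Set
Between c s p = ∀ y → lookup c y ≡ lookup s y → lookup p y ≡ lookup s y

module Descent {n} {H : CNF n} {P : List (Assignment n)} {centre : Assignment n}
  {Φ : Assignment n → Clause n} (ac : IsACMapping H P Φ)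
  (closed : ∀ p → p ∈ P → ∀ r → InNbhd3 centre p (Φ p) r → r ∈ P)
  {s : Assignment n} (s⊨H : SatCNF s H) where

  stepTowardModel : ∀ {p} → p ∈ P → Between centre s p →
                    ∃ λ r → r ∈ P × Between centre s r × hamming p s ≡ suc (hamming r s)
  stepTowardModel {p} p∈P p-between
    with separatingVariable s p (All.lookup s⊨H (proj₁ (ac p p∈P))) (proj₂ (ac p p∈P))
  ... | x , px≢sx , sat-if-agrees =
    flip p x , r∈P , r-between , hamming-flip-disagreeing p s x px≢sx
    where
    centrex≢sx : lookup centre x ≢ lookup s x
    centrex≢sx e = px≢sx (p-between x e)

    px≡centrex : lookup p x ≡ lookup centre x
    px≡centrex = trans (¬-not px≢sx) (sym (¬-not centrex≢sx))

    rx≡sx : lookup (flip p x) x ≡ lookup s x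
    rx≡sx = trans (lookup∘updateAt x p) (sym (¬-not (λ e → px≢sx (sym e))))

    r∈P : flip p x ∈ P
    r∈P = closed p p∈P (flip p x)
            ( (sat-if-agrees (flip p x) rx≡sx , hamming-flip p x)
            , ≤-reflexive (sym (hamming-flip-agreeing p centre x px≡centrex)))

    r-between : Between centre s (flip p x)
    r-between y e with y Fin.≟ x
    ... | yes refl = ⊥-elim (centrex≢sx e)
    ... | no y≢x   = trans (lookup∘updateAt′ y x y≢x p) (p-between y e)

  nothingBetweenInP : ∀ k {p} → hamming p s ≡ k → p ∈ P → Between centre s p → ⊥
  nothingBetweenInP k dist≡k p∈P p-between with stepTowardModel p∈P p-between | k
  ... | _ , _   , _         , dist≡1+ | zero  = 0≢1+n (trans (sym dist≡k) dist≡1+)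
  ... | _ , r∈P , r-between , dist≡1+ | suc k =
    nothingBetweenInP k (suc-injective (trans (sym dist≡1+) dist≡k)) r∈P r-between

hasSSA⇒unsatisfiable : ∀ {n} {H : CNF n} → HasSSA H → Unsatisfiable H
hasSSA⇒unsatisfiable (_ , centre , centre∈P , _ , _ , ac , closed) (s , s⊨H) =
  Descent.nothingBetweenInP ac closed {s} s⊨H _ refl centre∈P (λ _ e → e)

unsatisfiable⇒hasSSA : ∀ {n} {H : CNF n} → Unsatisfiable H → HasSSA H
unsatisfiable⇒hasSSA {n} {H} unsat =
  vectors (true ∷ false ∷ []) n , replicate n false , everything _ ,
  (λ p _ → falsifies p) , Φ , (λ p _ → proj₂ (falsifiedClause p (falsifies p))) ,
  (λ _ _ r _ → everything r)
  where
  everything : ∀ p → p ∈ vectors (true ∷ false ∷ []) n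
  everything = ∈-vectors ∈-booleans

  falsifies : ∀ p → FalsifiesCNF p H
  falsifies p p⊨H = unsat (p , p⊨H)

  Φ : Assignment n → Clause n
  Φ p = proj₁ (falsifiedClause p (falsifies p))

proposition1 : (n : ℕ) (H : CNF n) → VarsExactly H →
    Unsatisfiable H ⇔ HasSSA H
proposition1 n H _ = mk⇔ unsatisfiable⇒hasSSA hasSSA⇒unsatisfiable
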